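{- Let $0<\epsilon<1$. Every monotone function $f(z)=g(B_1(z),\dots,B_d(z))$ of $d$ monotone $(S,D,T)$-branching programs $B_1,\dots,B_d$ (with $g:\{0,1\}^d\to\{0,1\}$ monotone) has a pair of $(d\log(4T/\epsilon),D,T)$-branching programs $(B^{\mathrm{down}},B^{\mathrm{up}})$ that $(d\epsilon)$-sandwich it.
   Context: An $(S,D,T)$-branching program $B$ is a layered multigraph with layers $0,\dots,T$, at most $2^S$ vertices per layer, a single start vertex, last-layer vertices labeled $0$/$1$, and each vertex in layer $i<T$ having at most $2^D$ outgoing edges labeled by distinct elements of $\{0,1\}^D$ into layer $i+1$; $B(z)$ for $z\in(\{0,1\}^D)^T$ is the label reached following $z$. $\mathrm{Acc}_B(v)$ is the set of suffixes leading from vertex $v$ to acceptance; $B$ is monotone if each layer admits an ordering $v_1\prec\dots$ with $v\prec w\Rightarrow\mathrm{Acc}_B(v)\subseteq\mathrm{Acc}_B(w)$. A pair $(f_{\mathrm{down}},f_{\mathrm{up}})$ of functions $(\{0,1\}^D)^T\to\{0,1\}$ $\epsilon$-sandwiches $f$ if $f_{\mathrm{down}}(z)\le f(z)\le f_{\mathrm{up}}(z)$ for all $z$ and $\Pr_z[f_{\mathrm{up}}(z)=1]-\Pr_z[f_{\mathrm{down}}(z)=1]\le\epsilon$ for $z$ uniform. -}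

module Defs where

open import Data.Nat as ℕ using (ℕ; zero; suc; _+_; _*_; _∸_; _^_)
open import Data.Nat.Properties using (m^n≢0)
open import Data.Integer using (+_)
open import Data.Bool using (Bool; true; false; if_then_else_)
import Data.Bool as B
open import Data.Fin using (Fin)
open import Data.Maybe using (Maybe; maybe)
open import Data.List using (List; []; _∷_; concatMap; length; filter)
open import Data.Vec using (Vec; []; _∷_; toList; map)
open import Data.Vec.Relation.Binary.Pointwise.Inductive using (Pointwise)
open import Data.Product using (Σ; _×_)
open import Data.Rational as Q using (ℚ; 0ℚ; 1ℚ; _÷_; _/_)
open import Data.Rational.Properties using (pos⇒nonZero)
open import Function.Definitions using (Injective)
open import Relation.Binary.PropositionalEquality using (_≡_)
open import Relation.Nullary.Decidable using (yes; no)

-- A block of D bits (one symbol of the branching program's alphabet {0,1}^D).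
Word : ℕ → Set
Word D = Vec Bool D

-- A layered branching program reading T symbols from {0,1}^D.
-- Layers are indexed by natural numbers; only layers 0..T matter
-- (data for layers > T and labels of layers < T are never used).  The outgoing edges of a vertex
-- are labelled by distinct elements of {0,1}^D: a partial map from
-- labels to vertices of the next layer (nothing = no edge with that label).
record BP (D T : ℕ) : Set where
  field
    width : ℕ → ℕ
    start : Fin (width 0)
    next  : (i : ℕ) → Fin (width i) → Word D → Maybe (Fin (width (suc i)))
    label : (i : ℕ) → Fin (width i) → Bool

open BP public

-- Follow the input from vertex v in layer i; at the end of the input,
-- return the label of the vertex reached.  A missing edge means reject.
accepts : ∀ {D T} (B : BP D T) (i : ℕ) → Fin (width B i) → List (Word D) → Bool
accepts B i v []       = label B i v
accepts B i v (x ∷ xs) = maybe (λ u → accepts B (suc i) u xs) false (next B i v x)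

eval : ∀ {D T} → BP D T → Vec (Word D) T → Bool
eval B z = accepts B 0 (start B) (toList z)

Acc : ∀ {D T} (B : BP D T) (i : ℕ) → Fin (width B i) → Vec (Word D) (T ∸ i) → Set
Acc B i v y = accepts B i v (toList y) ≡ true

HasSpace : ∀ {D T} → BP D T → ℕ → Set
HasSpace {T = T} B S = ∀ i → i ℕ.≤ T → width B i ℕ.≤ 2 ^ S

-- At most W vertices in each layer 0..T, W a rational (W = 2^S for real S).
WidthAtMostℚ : ∀ {D T} → BP D T → ℚ → Set
WidthAtMostℚ {T = T} B W = ∀ i → i ℕ.≤ T → (+ width B i / 1) Q.≤ W

-- Monotone: every layer i ≤ T admits a linear ordering (given by an
-- injective rank function) with v ≺ w ⇒ Acc(v) ⊆ Acc(w).
Monotone : ∀ {D T} → BP D T → Set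
Monotone {T = T} B =
  ∀ i → i ℕ.≤ T →
  Σ (Fin (width B i) → ℕ) λ rank →
    Injective _≡_ _≡_ rank ×
    (∀ v w → rank v ℕ.< rank w → ∀ y → Acc B i v y → Acc B i w y)

MonotoneFn : ∀ {d} → (Vec Bool d → Bool) → Set
MonotoneFn {d} g = ∀ x y → Pointwise B._≤_ x y → g x B.≤ g y

allVecs : ∀ {A : Set} → List A → (n : ℕ) → List (Vec A n)
allVecs xs zero    = [] ∷ []
allVecs xs (suc n) = concatMap (λ x → Data.List.map (x ∷_) (allVecs xs n)) xs

allWords : (D : ℕ) → List (Word D)
allWords D = allVecs (false ∷ true ∷ []) D

count : (D T : ℕ) → (Vec (Word D) T → Bool) → ℕ
count D T F = length (filter (λ z → F z Data.Bool.≟ true) (allVecs (allWords D) T))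

Pr : (D T : ℕ) → (Vec (Word D) T → Bool) → ℚ
Pr D T F = (+ count D T F / (2 ^ (D * T))) {{m^n≢0 2 (D * T)}}

Sandwiches : (D T : ℕ) → ℚ → (fdown f fup : Vec (Word D) T → Bool) → Set
Sandwiches D T ε fdown f fup =
  (∀ z → (fdown z B.≤ f z) × (f z B.≤ fup z)) ×
  ((Pr D T fup Q.- Pr D T fdown) Q.≤ ε)

powℚ : ℚ → ℕ → ℚ
powℚ q zero    = 1ℚ
powℚ q (suc n) = q Q.* powℚ q n

-- 2^(d log(4T/ε)) = (4T/ε)^d.
sandwichWidth : (d T : ℕ) (ε : ℚ) → 0ℚ Q.< ε → ℚ
sandwichWidth d T ε ε>0 =
  powℚ (((+ (4 * T) / 1) ÷ ε) {{pos⇒nonZero ε {{Q.positive ε>0}}}}) d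

module Submission where

-- Fix a resolution q.  Put every vertex v of layer i of a program B into the
-- bucket ⌊q·N(v)/M⌋ ∈ {0,…,q}, where N(v) counts the accepted suffixes (of
-- length n = T − i) and M = 2^(Dn).  Replacing every vertex by a fixed
-- representative of its bucket gives a width-(q+1) automaton whose acceptance
-- count differs from that of B by at most T·M/q: each layer of rounding moves
-- a count by less than M/q.  By monotonicity the accepting sets of a layer
-- form a chain, so the least (greatest) member of each bucket as representative
-- gives an automaton below (above) B.  Running the d rounded automata in
-- parallel and applying g yields two programs of width (q+1)^d that sandwich f
-- (g is monotone), and a union bound over the coordinates bounds the gap of
-- their counts by d·2T·M/q.  The choice q = ⌊2T/ε⌋ + 1 makes this at most dε
-- while q + 1 ≤ 4T/ε.

open import Defs

-- It is kept in its own module since the operators of ℕ and ℚ clash.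
module Rationals where

  open import Data.Nat as ℕ using (ℕ; zero; suc; pred; NonZero; z≤n; s≤s)
  import Data.Nat.Properties as ℕP
  open import Data.Integer as ℤ using (+_; +≤+)
  open import Relation.Binary.PropositionalEquality
  import Data.Integer.Properties as ℤP
  open import Data.Rational as ℚ using (ℚ; mkℚ; _/_; 0ℚ; 1ℚ; _≤_; _<_; _+_; _*_; _-_; _÷_; 1/_;
                                        Positive; toℚᵘ; *<*)
  open import Data.Rational.Properties
  open import Data.Rational.Unnormalised as ℚᵘ using (mkℚᵘ; *≤*; *≡*)
  import Data.Rational.Unnormalised.Properties as ℚᵘP
  import Data.Rational.Solver as ℚSolver
  open ℚSolver.+-*-Solver using () renaming (solve to solveℚ; _:+_ to _⊕_; _:*_ to _⊗_; _:-_ to _⊖_; _:=_ to _⊜_)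

  ι : ℕ → ℚ
  ι n = + n / 1

  toℚᵘ-/ : ∀ i n .{{_ : NonZero n}} → toℚᵘ (i / n) ℚᵘ.≃ mkℚᵘ i (pred n)
  toℚᵘ-/ i (suc k) = toℚᵘ-fromℚᵘ (mkℚᵘ i k)

  ι-mono : ∀ {a b} → a ℕ.≤ b → ι a ≤ ι b
  ι-mono {a} {b} a≤b = toℚᵘ-cancel-≤
    (ℚᵘP.≤-respʳ-≃ (ℚᵘP.≃-sym (toℚᵘ-/ (+ b) 1)) (ℚᵘP.≤-respˡ-≃ (ℚᵘP.≃-sym (toℚᵘ-/ (+ a) 1))
      (*≤* (subst₂ ℤ._≤_ (sym (ℤP.*-identityʳ (+ a))) (sym (ℤP.*-identityʳ (+ b))) (+≤+ a≤b)))))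

  ι-+ : ∀ a b → ι (a ℕ.+ b) ≡ ι a + ι b
  ι-+ a b = toℚᵘ-injective (ℚᵘP.≃-trans (toℚᵘ-/ (+ (a ℕ.+ b)) 1) (ℚᵘP.≃-sym
    (ℚᵘP.≃-trans (toℚᵘ-homo-+ (ι a) (ι b)) (ℚᵘP.≃-trans (ℚᵘP.+-cong (toℚᵘ-/ (+ a) 1) (toℚᵘ-/ (+ b) 1))
      (*≡* (cong (ℤ._* + 1) (cong₂ ℤ._+_ (ℤP.*-identityʳ (+ a)) (ℤP.*-identityʳ (+ b)))))))))

  ι-* : ∀ a b → ι (a ℕ.* b) ≡ ι a * ι b
  ι-* a b = toℚᵘ-injective (ℚᵘP.≃-trans (toℚᵘ-/ (+ (a ℕ.* b)) 1) (ℚᵘP.≃-sym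
    (ℚᵘP.≃-trans (toℚᵘ-homo-* (ι a) (ι b)) (ℚᵘP.≃-trans (ℚᵘP.*-cong (toℚᵘ-/ (+ a) 1) (toℚᵘ-/ (+ b) 1))
      (*≡* (cong (ℤ._* + 1) (sym (ℤP.pos-* a b))))))))

  ι-positive : ∀ n .{{_ : NonZero n}} → Positive (ι n)
  ι-positive (suc k) = normalize-pos (suc k) 1

  clear-denominator : ∀ (p : ℚ) c k → toℚᵘ p ℚᵘ.≃ mkℚᵘ (+ c) k → p * ι (suc k) ≡ ι c
  clear-denominator p c k p≃ = toℚᵘ-injective
    (ℚᵘP.≃-trans (toℚᵘ-homo-* p (ι (suc k)))
      (ℚᵘP.≃-trans (ℚᵘP.*-cong p≃ (toℚᵘ-/ (+ suc k) 1)) (ℚᵘP.≃-sym (ℚᵘP.≃-trans (toℚᵘ-/ (+ c) 1) scale))))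
    where
    scale : mkℚᵘ (+ c) 0 ℚᵘ.≃ mkℚᵘ (+ c) k ℚᵘ.* mkℚᵘ (+ suc k) 0
    scale = *≡* (trans (cong (+ c ℤ.*_) (ℤP.pos-* (suc k) 1)) (sym (ℤP.*-assoc (+ c) (+ suc k) (+ 1))))

  /-clear : ∀ a M .{{_ : NonZero M}} → (+ a / M) * ι M ≡ ι a
  /-clear a (suc m) = clear-denominator (+ a / suc m) a m (toℚᵘ-/ (+ a) (suc m))

  record ProperFraction (ε : ℚ) : Set where
    field
      num den : ℕ
      num>0   : num ℕ.> 0
      num<den : num ℕ.< den
      ε·den   : ε * ι den ≡ ι num

    den≢0 : NonZero den
    den≢0 = ℕ.>-nonZero (ℕP.<-trans num>0 num<den)

  proper-fraction : ∀ ε → 0ℚ < ε → ε < 1ℚ → ProperFraction ε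
  proper-fraction (mkℚ (+ suc n) d-1 _) _ ε<1 = record
    { num     = suc n
    ; den     = suc d-1
    ; num>0   = s≤s z≤n
    ; num<den = subst₂ ℕ._<_ (ℕP.*-identityʳ (suc n)) (ℕP.+-identityʳ (suc d-1)) (ℤP.drop‿+<+ (drop-*<* ε<1))
    ; ε·den   = clear-denominator _ (suc n) d-1 ℚᵘP.≃-refl }
  proper-fraction (mkℚ (+ 0) _ _)     (*<* (ℤ.+<+ ())) _
  proper-fraction (mkℚ ℤ.-[1+ _ ] _ _) (*<* ())        _

  fraction-gap : ∀ a b d M .{{_ : NonZero M}} ε num den .{{_ : NonZero den}} → ε * ι den ≡ ι num →
                 a ℕ.* den ℕ.≤ b ℕ.* den ℕ.+ d ℕ.* M ℕ.* num → (+ a / M) - (+ b / M) ≤ ι d * ε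
  fraction-gap a b d M ε num den ε·den bound =
    subst (u - v ≤_) (solveℚ 2 (λ v δ → (v ⊕ δ) ⊖ v ⊜ δ) refl v (ι d * ε)) shifted
    where
    u v : ℚ
    u = + a / M
    v = + b / M
    lhs : u * (ι M * ι den) ≡ ι (a ℕ.* den)
    lhs = begin-equality
      u * (ι M * ι den)   ≡⟨ *-assoc u (ι M) (ι den) ⟨
      u * ι M * ι den     ≡⟨ cong (_* ι den) (/-clear a M) ⟩
      ι a * ι den         ≡⟨ ι-* a den ⟨
      ι (a ℕ.* den)       ∎
      where open ≤-Reasoning
    rhs : (v + ι d * ε) * (ι M * ι den) ≡ ι (b ℕ.* den ℕ.+ d ℕ.* M ℕ.* num)
    rhs = begin-equality
      (v + ι d * ε) * (ι M * ι den)
        ≡⟨ solveℚ 5 (λ v d ε M n → (v ⊕ d ⊗ ε) ⊗ (M ⊗ n) ⊜ v ⊗ M ⊗ n ⊕ d ⊗ M ⊗ (ε ⊗ n)) refl v (ι d) ε (ι M) (ι den) ⟩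
      v * ι M * ι den + ι d * ι M * (ε * ι den)
        ≡⟨ cong₂ (λ x y → x * ι den + ι d * ι M * y) (/-clear b M) ε·den ⟩
      ι b * ι den + ι d * ι M * ι num
        ≡⟨ cong₂ _+_ (ι-* b den) (trans (ι-* (d ℕ.* M) num) (cong (_* ι num) (ι-* d M))) ⟨
      ι (b ℕ.* den) + ι (d ℕ.* M ℕ.* num)
        ≡⟨ ι-+ (b ℕ.* den) (d ℕ.* M ℕ.* num) ⟨
      ι (b ℕ.* den ℕ.+ d ℕ.* M ℕ.* num) ∎
      where open ≤-Reasoning
    scaled : u * (ι M * ι den) ≤ (v + ι d * ε) * (ι M * ι den)
    scaled = subst₂ _≤_ (sym lhs) (sym rhs) (ι-mono bound)
    shifted : u - v ≤ (v + ι d * ε) - v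
    shifted = +-monoˡ-≤ (ℚ.- v)
      (*-cancelʳ-≤-pos {u} {v + ι d * ε} (ι M * ι den) {{pos*pos⇒pos (ι M) {{ι-positive M}} (ι den) {{ι-positive den}}}} scaled)

  below-inverse : ∀ K c ε .{{_ : Positive ε}} num den .{{_ : NonZero den}} → ε * ι den ≡ ι num →
                  K ℕ.* num ℕ.≤ c ℕ.* den → ι K ≤ (ι c ÷ ε) {{pos⇒nonZero ε}}
  below-inverse K c ε num den ε·den bound = *-cancelʳ-≤-pos ε (begin
    ι K * ε            ≤⟨ *-cancelʳ-≤-pos (ι den) {{ι-positive den}} scaled ⟩
    ι c                ≡⟨ *-identityʳ (ι c) ⟨
    ι c * 1ℚ           ≡⟨ cong (ι c *_) (*-inverseˡ ε) ⟨
    ι c * (1/ ε * ε)   ≡⟨ *-assoc (ι c) (1/ ε) ε ⟨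
    (ι c ÷ ε) * ε      ∎)
    where
    instance _ = pos⇒nonZero ε
    open ≤-Reasoning
    scaled : ι K * ε * ι den ≤ ι c * ι den
    scaled = subst₂ _≤_ (trans (ι-* K num) (trans (cong (ι K *_) (sym ε·den)) (sym (*-assoc (ι K) ε (ι den)))))
                        (ι-* c den) (ι-mono bound)

  ι-pow : ∀ K d → ι (K ℕ.^ d) ≡ powℚ (ι K) d
  ι-pow K zero    = refl
  ι-pow K (suc d) = trans (ι-* K (K ℕ.^ d)) (cong (ι K *_) (ι-pow K d))

  powℚ-nonNeg : ∀ x → 0ℚ ≤ x → ∀ d → 0ℚ ≤ powℚ x d
  powℚ-nonNeg x x≥0 zero    = ι-mono {0} {1} z≤n
  powℚ-nonNeg x x≥0 (suc d) = nonNegative⁻¹ (x * powℚ x d)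
    {{nonNeg*nonNeg⇒nonNeg x {{ℚ.nonNegative x≥0}} (powℚ x d) {{ℚ.nonNegative (powℚ-nonNeg x x≥0 d)}}}}

  powℚ-mono : ∀ {x y} → 0ℚ ≤ x → x ≤ y → ∀ d → powℚ x d ≤ powℚ y d
  powℚ-mono x≥0 x≤y zero    = ≤-refl
  powℚ-mono {x} {y} x≥0 x≤y (suc d) =
    ≤-trans (*-monoʳ-≤-nonNeg (powℚ x d) {{ℚ.nonNegative (powℚ-nonNeg x x≥0 d)}} x≤y)
            (*-monoˡ-≤-nonNeg y {{ℚ.nonNegative (≤-trans x≥0 x≤y)}} (powℚ-mono x≥0 x≤y d))

open import Data.Bool as Bool using (Bool; true; false)
import Data.Bool.Properties as BoolP
open import Data.Empty using (⊥-elim)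
open import Data.Fin as Fin using (Fin; fromℕ<; toℕ; funToFin; finToFun)
open import Data.Fin.Properties using (toℕ-fromℕ<; finToFun-funToFin)
open import Data.List as List using (List; []; _∷_; _++_; length; filter; concatMap; allFin)
open import Data.List.Membership.Propositional using (_∈_)
open import Data.List.Membership.Propositional.Properties using (∈-allFin; ∈-map⁺; ∈-filter⁺; ∈-filter⁻)
open import Data.List.Relation.Unary.Any using (here; there)
import Data.List.Relation.Unary.All as ListAll
import Data.List.Extrema as Extrema
open import Data.Maybe using (Maybe; just; nothing)
open import Data.Nat
open import Data.Nat.Properties
open import Data.Nat.DivMod using (_/_; _%_; m≡m%n+[m/n]*n; m%n<n; m/n*n≤m; m*n/n≡m; /-monoˡ-≤)
open import Data.Nat.Solver using (module +-*-Solver)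
open import Data.Product using (Σ; _×_; _,_; proj₁; proj₂)
open import Data.Sum using (_⊎_; inj₁; inj₂)
open import Data.Vec as Vec using (Vec; []; _∷_; toList; tabulate)
open import Data.Vec.Properties using (tabulate-cong; tabulate-∘; tabulate∘lookup)
open import Data.Vec.Relation.Binary.Pointwise.Inductive as Pointwise using (Pointwise; []; _∷_)
open import Data.Vec.Relation.Unary.All using (All)
open import Data.Vec.Relation.Unary.All.Properties using (lookup⁺)
open import Data.Rational as ℚ using (ℚ; 0ℚ; 1ℚ)
import Data.Integer as ℤ
open import Function using (_∘_; flip)
open import Level using (0ℓ)
open import Relation.Binary using (Rel; TotalOrder; IsTotalOrder; Reflexive; Transitive)
import Relation.Binary.Properties.TotalOrder as TotalOrderProperties
open import Relation.Binary.PropositionalEquality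
open import Relation.Nullary using (Dec; yes; no)

open +-*-Solver using (solve; _:+_; _:*_; _:=_; con)
open Rationals

indicator : Bool → ℕ
indicator false = 0
indicator true  = 1

indicator≤1 : ∀ b → indicator b ≤ 1
indicator≤1 false = z≤n
indicator≤1 true  = s≤s z≤n

sumOver : {A : Set} → List A → (A → ℕ) → ℕ
sumOver []       h = 0
sumOver (x ∷ xs) h = h x + sumOver xs h

module _ {A : Set} where

  sumOver-cong : ∀ (xs : List A) {h h′ : A → ℕ} → (∀ x → h x ≡ h′ x) →
                 sumOver xs h ≡ sumOver xs h′
  sumOver-cong []       _ = refl
  sumOver-cong (x ∷ xs) e = cong₂ _+_ (e x) (sumOver-cong xs e)

  sumOver-mono : ∀ (xs : List A) {h h′ : A → ℕ} → (∀ x → h x ≤ h′ x) →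
                 sumOver xs h ≤ sumOver xs h′
  sumOver-mono []       _ = z≤n
  sumOver-mono (x ∷ xs) e = +-mono-≤ (e x) (sumOver-mono xs e)

  sumOver-+ : ∀ (xs : List A) (h h′ : A → ℕ) →
              sumOver xs (λ x → h x + h′ x) ≡ sumOver xs h + sumOver xs h′
  sumOver-+ []       h h′ = refl
  sumOver-+ (x ∷ xs) h h′ =
    trans (cong (h x + h′ x +_) (sumOver-+ xs h h′))
          (solve 4 (λ a b c d → a :+ b :+ (c :+ d) := a :+ c :+ (b :+ d)) refl
                 (h x) (h′ x) (sumOver xs h) (sumOver xs h′))

  sumOver-*ʳ : ∀ (xs : List A) (h : A → ℕ) c → sumOver xs (λ x → h x * c) ≡ sumOver xs h * c
  sumOver-*ʳ []       h c = refl
  sumOver-*ʳ (x ∷ xs) h c =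
    trans (cong (h x * c +_) (sumOver-*ʳ xs h c)) (sym (*-distribʳ-+ c (h x) _))

  sumOver-*ˡ : ∀ (xs : List A) (h : A → ℕ) c → sumOver xs (λ x → c * h x) ≡ c * sumOver xs h
  sumOver-*ˡ []       h c = sym (*-zeroʳ c)
  sumOver-*ˡ (x ∷ xs) h c =
    trans (cong (c * h x +_) (sumOver-*ˡ xs h c)) (sym (*-distribˡ-+ c (h x) _))

  sumOver-++ : ∀ (xs ys : List A) (h : A → ℕ) → sumOver (xs ++ ys) h ≡ sumOver xs h + sumOver ys h
  sumOver-++ []       ys h = refl
  sumOver-++ (x ∷ xs) ys h = trans (cong (h x +_) (sumOver-++ xs ys h)) (sym (+-assoc (h x) _ _))

  sumOver-const : ∀ (xs : List A) c → sumOver xs (λ _ → c) ≡ length xs * c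
  sumOver-const []       c = refl
  sumOver-const (x ∷ xs) c = cong (c +_) (sumOver-const xs c)

sumOver-map : ∀ {A B : Set} (f : A → B) (xs : List A) (h : B → ℕ) →
              sumOver (List.map f xs) h ≡ sumOver xs (h ∘ f)
sumOver-map f []       h = refl
sumOver-map f (x ∷ xs) h = cong (h (f x) +_) (sumOver-map f xs h)

total : {A : Set} → List A → (n : ℕ) → (Vec A n → ℕ) → ℕ
total xs zero    h = h []
total xs (suc n) h = sumOver xs (λ x → total xs n (λ z → h (x ∷ z)))

module _ {A : Set} (xs : List A) where

  total-cong : ∀ n {h h′ : Vec A n → ℕ} → (∀ z → h z ≡ h′ z) → total xs n h ≡ total xs n h′
  total-cong zero    e = e []
  total-cong (suc n) e = sumOver-cong xs (λ x → total-cong n (λ z → e (x ∷ z)))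

  total-mono : ∀ n {h h′ : Vec A n → ℕ} → (∀ z → h z ≤ h′ z) → total xs n h ≤ total xs n h′
  total-mono zero    e = e []
  total-mono (suc n) e = sumOver-mono xs (λ x → total-mono n (λ z → e (x ∷ z)))

  total-+ : ∀ n (h h′ : Vec A n → ℕ) → total xs n (λ z → h z + h′ z) ≡ total xs n h + total xs n h′
  total-+ zero    h h′ = refl
  total-+ (suc n) h h′ = trans (sumOver-cong xs (λ x → total-+ n _ _)) (sumOver-+ xs _ _)

  total-const : ∀ n c → total xs n (λ _ → c) ≡ length xs ^ n * c
  total-const zero    c = sym (+-identityʳ c)
  total-const (suc n) c = begin
    sumOver xs (λ _ → total xs n (λ _ → c)) ≡⟨ sumOver-cong xs (λ _ → total-const n c) ⟩
    sumOver xs (λ _ → length xs ^ n * c)    ≡⟨ sumOver-const xs (length xs ^ n * c) ⟩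
    length xs * (length xs ^ n * c)         ≡⟨ *-assoc (length xs) (length xs ^ n) c ⟨
    length xs * length xs ^ n * c           ∎
    where open ≡-Reasoning

  sumOver-allVecs : ∀ n (h : Vec A n → ℕ) → sumOver (allVecs xs n) h ≡ total xs n h
  sumOver-allVecs zero    h = +-identityʳ (h [])
  sumOver-allVecs (suc n) h =
    trans (split xs) (sumOver-cong xs (λ x → sumOver-allVecs n (λ z → h (x ∷ z))))
    where
    split : ∀ ys → sumOver (concatMap (λ x → List.map (x ∷_) (allVecs xs n)) ys) h
                 ≡ sumOver ys (λ x → sumOver (allVecs xs n) (λ z → h (x ∷ z)))
    split []       = refl
    split (y ∷ ys) = trans (sumOver-++ (List.map (y ∷_) (allVecs xs n)) _ h)
                           (cong₂ _+_ (sumOver-map (y ∷_) (allVecs xs n) h) (split ys))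

inputs : (D n : ℕ) → ℕ
inputs D n = total (allWords D) n (λ _ → 1)

acceptances : ∀ {D n} → (Vec (Word D) n → Bool) → ℕ
acceptances {D} {n} F = total (allWords D) n (indicator ∘ F)

inputs≡ : ∀ D n → inputs D n ≡ 2 ^ (D * n)
inputs≡ D n = begin
  total (allWords D) n (λ _ → 1) ≡⟨ total-const (allWords D) n 1 ⟩
  length (allWords D) ^ n * 1    ≡⟨ cong (λ l → l ^ n * 1) words ⟩
  (2 ^ D * 1) ^ n * 1            ≡⟨ cong (λ l → l ^ n * 1) (*-identityʳ (2 ^ D)) ⟩
  (2 ^ D) ^ n * 1                ≡⟨ *-identityʳ _ ⟩
  (2 ^ D) ^ n                    ≡⟨ ^-*-assoc 2 D n ⟩
  2 ^ (D * n)                    ∎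
  where
  open ≡-Reasoning
  bits : List Bool
  bits = false ∷ true ∷ []
  words : length (allWords D) ≡ 2 ^ D * 1
  words = begin
    length (allVecs bits D)              ≡⟨ *-identityʳ _ ⟨
    length (allVecs bits D) * 1          ≡⟨ sumOver-const (allVecs bits D) 1 ⟨
    sumOver (allVecs bits D) (λ _ → 1)   ≡⟨ sumOver-allVecs bits D (λ _ → 1) ⟩
    total bits D (λ _ → 1)               ≡⟨ total-const bits D 1 ⟩
    2 ^ D * 1                            ∎

inputs≢0 : ∀ D n → NonZero (inputs D n)
inputs≢0 D n = subst NonZero (sym (inputs≡ D n)) (m^n≢0 2 (D * n))

accepted-≤-inputs : ∀ {D n} (F : Vec (Word D) n → Bool) → acceptances F ≤ inputs D n
accepted-≤-inputs {D} {n} F = total-mono (allWords D) n (λ z → indicator≤1 (F z))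

count≡acceptances : ∀ D n (F : Vec (Word D) n → Bool) → count D n F ≡ acceptances F
count≡acceptances D n F =
  trans (filter-length (allVecs (allWords D) n)) (sumOver-allVecs (allWords D) n _)
  where
  filter-length : ∀ zs → length (filter (λ z → F z Bool.≟ true) zs) ≡ sumOver zs (indicator ∘ F)
  filter-length []       = refl
  filter-length (z ∷ zs) with F z
  ... | true  = cong suc (filter-length zs)
  ... | false = filter-length zs

record Automaton (D K : ℕ) : Set where
  field
    move    : ℕ → Fin K → Word D → Fin K
    output  : ℕ → Fin K → Bool
    initial : Fin K

open Automaton public

run : ∀ {D K} → Automaton D K → ℕ → Fin K → List (Word D) → Bool
run A i k []       = output A i k
run A i k (w ∷ ws) = run A (suc i) (move A i k w) ws

evalA : ∀ {D K n} → Automaton D K → Vec (Word D) n → Bool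
evalA A z = run A 0 (initial A) (toList z)

-- Accumulated rounding errors, with all counts scaled by q and M the number
-- of suffixes: composing one rounding step (a < b + M) with m earlier ones.
near-then-close : ∀ {a b c M m} → a < b + M → b + M ≤ suc (c + m * M) → a + M ≤ c + suc m * M
near-then-close {a} {b} {c} {M} {m} a<b+M b+M≤ = begin
  a + M         ≤⟨ +-monoˡ-≤ M (s≤s⁻¹ (≤-trans a<b+M b+M≤)) ⟩
  c + m * M + M ≡⟨ solve 3 (λ c mM M → c :+ mM :+ M := c :+ (M :+ mM)) refl c (m * M) M ⟩
  c + suc m * M ∎
  where open ≤-Reasoning

close-then-near : ∀ {a b c M m} → a + M ≤ suc (b + m * M) → b < c + M → a + M ≤ c + suc m * M
close-then-near {a} {b} {c} {M} {m} a+M≤ b<c+M = begin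
  a + M         ≤⟨ a+M≤ ⟩
  suc b + m * M ≤⟨ +-monoˡ-≤ (m * M) b<c+M ⟩
  c + M + m * M ≡⟨ +-assoc c M (m * M) ⟩
  c + suc m * M ∎
  where open ≤-Reasoning

-- Cancelling one M: at the start vertex this turns the (T+1)·M of the
-- chain of roundings into T·M.
drop-extra : ∀ {a c M m} → a + M ≤ c + suc m * M → a ≤ c + m * M
drop-extra {a} {c} {M} {m} h =
  +-cancelʳ-≤ M a (c + m * M)
    (subst (a + M ≤_) (solve 3 (λ c M mM → c :+ (M :+ mM) := c :+ mM :+ M) refl c M (m * M)) h)

module Rounding {D T : ℕ} (B : BP D T) (q : ℕ) where

  -- Layer-i vertices completed by a rejecting sink, so that transitions are total.
  Vertex : ℕ → Set
  Vertex i = Maybe (Fin (width B i))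

  move⁺ : ∀ i → Vertex i → Word D → Vertex (suc i)
  move⁺ i nothing  w = nothing
  move⁺ i (just v) w = next B i v w

  accepts⁺ : ∀ i → Vertex i → List (Word D) → Bool
  accepts⁺ i nothing  ys = false
  accepts⁺ i (just v) ys = accepts B i v ys

  accepts⁺-step : ∀ i x w ys → accepts⁺ i x (w ∷ ys) ≡ accepts⁺ (suc i) (move⁺ i x w) ys
  accepts⁺-step i nothing  w ys = refl
  accepts⁺-step i (just v) w ys with next B i v w
  ... | nothing = refl
  ... | just u  = refl

  vertices : ∀ i → List (Vertex i)
  vertices i = nothing ∷ List.map just (allFin (width B i))

  ∈-vertices : ∀ i x → x ∈ vertices i
  ∈-vertices i nothing  = here refl
  ∈-vertices i (just v) = there (∈-map⁺ just (∈-allFin v))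

  accCount : ∀ n i → Vertex i → ℕ
  accCount n i x = acceptances {D} {n} (λ y → accepts⁺ i x (toList y))

  accCount-step : ∀ m i x → accCount (suc m) i x ≡ sumOver (allWords D) (λ w → accCount m (suc i) (move⁺ i x w))
  accCount-step m i x = sumOver-cong (allWords D) (λ w →
    total-cong (allWords D) m (λ z → cong indicator (accepts⁺-step i x w (toList z))))

  level : ∀ i → Vertex i → ℕ
  level i x = (accCount (T ∸ i) i x * q / inputs D (T ∸ i)) {{inputs≢0 D (T ∸ i)}}

  level≤q : ∀ i x → level i x ≤ q
  level≤q i x = begin
    accCount n i x * q / M ≤⟨ /-monoˡ-≤ M (*-monoˡ-≤ q (accepted-≤-inputs {D} {n} _)) ⟩
    M * q / M              ≡⟨ cong (_/ M) (*-comm M q) ⟩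
    q * M / M              ≡⟨ m*n/n≡m q M ⟩
    q                      ∎
    where
    open ≤-Reasoning
    n M : ℕ
    n = T ∸ i
    M = inputs D n
    instance _ = inputs≢0 D n

  bucket : ∀ i → Vertex i → Fin (suc q)
  bucket i x = fromℕ< (s≤s (level≤q i x))

  remaining : ∀ {i n} → i + n ≡ T → T ∸ i ≡ n
  remaining {i} {n} refl = m+n∸m≡n i n

  same-bucket⇒near : ∀ {i n} → i + n ≡ T → ∀ x y → bucket i x ≡ bucket i y →
                     accCount n i x * q < accCount n i y * q + inputs D n
  same-bucket⇒near {i} {n} e x y same =
    subst (λ n → accCount n i x * q < accCount n i y * q + inputs D n) (remaining {i} {n} e) (begin-strict
      a                   ≡⟨ m≡m%n+[m/n]*n a M ⟩
      a % M + a / M * M   <⟨ +-monoˡ-< (a / M * M) (m%n<n a M) ⟩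
      M + a / M * M       ≡⟨ cong (λ l → M + l * M) same-level ⟩
      M + c / M * M       ≤⟨ +-monoʳ-≤ M (m/n*n≤m c M) ⟩
      M + c               ≡⟨ +-comm M c ⟩
      c + M               ∎)
    where
    open ≤-Reasoning
    M a c : ℕ
    M = inputs D (T ∸ i)
    a = accCount (T ∸ i) i x * q
    c = accCount (T ∸ i) i y * q
    instance _ = inputs≢0 D (T ∸ i)
    same-level : a / M ≡ c / M
    same-level = trans (sym (toℕ-fromℕ< (s≤s (level≤q i x))))
                       (trans (cong toℕ same) (toℕ-fromℕ< (s≤s (level≤q i y))))

  module Represented (rep : ∀ i → Fin (suc q) → Vertex i)
                     (rep-bucket : ∀ i x → bucket i (rep i (bucket i x)) ≡ bucket i x) where

    automaton : Automaton D (suc q)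
    automaton = record
      { move    = λ i k w → bucket (suc i) (move⁺ i (rep i k) w)
      ; output  = λ i k → accepts⁺ i (rep i k) []
      ; initial = bucket 0 (just (start B)) }

    roundedCount : ∀ n i → Fin (suc q) → ℕ
    roundedCount n i k = acceptances {D} {n} (λ y → run automaton i k (toList y))

    -- a is at most b up to n roundings: a·q + M ≤ b·q + n·M + 1 (the bottom
    -- layer is rounded exactly, which the +1 records).
    Close : ℕ → ℕ → ℕ → Set
    Close n a b = a * q + inputs D n ≤ suc (b * q + n * inputs D n)

    sum-close : ∀ m (f g : Word D → ℕ) →
                (∀ w → f w * q + inputs D m ≤ g w * q + suc m * inputs D m) →
                Close (suc m) (sumOver (allWords D) f) (sumOver (allWords D) g)
    sum-close m f g per-word = m≤n⇒m≤1+n (begin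
      sumOver W f * q + inputs D (suc m)
        ≡⟨ cong (_+ inputs D (suc m)) (sumOver-*ʳ W f q) ⟨
      sumOver W (λ w → f w * q) + inputs D (suc m)
        ≡⟨ sumOver-+ W (λ w → f w * q) (λ _ → inputs D m) ⟨
      sumOver W (λ w → f w * q + inputs D m)
        ≤⟨ sumOver-mono W per-word ⟩
      sumOver W (λ w → g w * q + suc m * inputs D m)
        ≡⟨ sumOver-+ W (λ w → g w * q) (λ _ → suc m * inputs D m) ⟩
      sumOver W (λ w → g w * q) + sumOver W (λ _ → suc m * inputs D m)
        ≡⟨ cong₂ _+_ (sumOver-*ʳ W g q) (sumOver-*ˡ W (λ _ → inputs D m) (suc m)) ⟩
      sumOver W g * q + suc m * inputs D (suc m) ∎)
      where
      open ≤-Reasoning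
      W : List (Word D)
      W = allWords D

    rounding-error : ∀ n i → i + n ≡ T → ∀ k →
      Close n (accCount n i (rep i k)) (roundedCount n i k) ×
      Close n (roundedCount n i k) (accCount n i (rep i k))
    rounding-error zero    i _ k = exact (accCount 0 i (rep i k)) , exact (roundedCount 0 i k)
      where
      exact : ∀ a → a * q + 1 ≤ suc (a * q + 0)
      exact a = ≤-reflexive (trans (+-comm (a * q) 1) (cong suc (sym (+-identityʳ (a * q)))))
    rounding-error (suc m) i e k =
      subst (λ a → Close (suc m) a (roundedCount (suc m) i k)) (sym (accCount-step m i r)) (sum-close m N′ R′ rep-below) ,
      subst (Close (suc m) (roundedCount (suc m) i k)) (sym (accCount-step m i r)) (sum-close m R′ N′ rep-above)
      where
      r : Vertex i
      r = rep i k
      e′ : suc i + m ≡ T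
      e′ = trans (sym (+-suc i m)) e
      succ : Word D → Vertex (suc i)
      succ w = move⁺ i r w
      representative : Word D → Vertex (suc i)
      representative w = rep (suc i) (bucket (suc i) (succ w))
      N′ R′ : Word D → ℕ
      N′ w = accCount m (suc i) (succ w)
      R′ w = roundedCount m (suc i) (bucket (suc i) (succ w))
      rep-below : ∀ w → N′ w * q + inputs D m ≤ R′ w * q + suc m * inputs D m
      rep-below w = near-then-close {M = inputs D m} {m = m}
        (same-bucket⇒near e′ (succ w) (representative w) (sym (rep-bucket (suc i) (succ w))))
        (proj₁ (rounding-error m (suc i) e′ (bucket (suc i) (succ w))))
      rep-above : ∀ w → R′ w * q + inputs D m ≤ N′ w * q + suc m * inputs D m
      rep-above w = close-then-near {M = inputs D m} {m = m}
        (proj₂ (rounding-error m (suc i) e′ (bucket (suc i) (succ w))))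
        (same-bucket⇒near e′ (representative w) (succ w) (rep-bucket (suc i) (succ w)))

    count-error : acceptances (eval B) * q ≤ acceptances {n = T} (evalA automaton) * q + T * inputs D T
                × acceptances {n = T} (evalA automaton) * q ≤ acceptances (eval B) * q + T * inputs D T
    count-error =
      drop-extra {m = T} (near-then-close {M = M} {m = T} (same-bucket⇒near refl s r (sym (rep-bucket 0 s))) below) ,
      drop-extra {m = T} (close-then-near {M = M} {m = T} above (same-bucket⇒near refl r s (rep-bucket 0 s)))
      where
      s r : Vertex 0
      s = just (start B)
      r = rep 0 (bucket 0 s)
      M : ℕ
      M = inputs D T
      below : Close T (accCount T 0 r) (roundedCount T 0 (bucket 0 s))
      below = proj₁ (rounding-error T 0 refl (bucket 0 s))
      above : Close T (roundedCount T 0 (bucket 0 s)) (accCount T 0 r)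
      above = proj₂ (rounding-error T 0 refl (bucket 0 s))

    module _ (R : Bool → Bool → Set) (R-refl : Reflexive R) (R-trans : Transitive R)
             (rep-R : ∀ i n → i + n ≡ T → ∀ x (y : Vec (Word D) n) →
                      R (accepts⁺ i (rep i (bucket i x)) (toList y)) (accepts⁺ i x (toList y))) where

      run-R : ∀ n i → i + n ≡ T → ∀ k (y : Vec (Word D) n) →
              R (run automaton i k (toList y)) (accepts⁺ i (rep i k) (toList y))
      run-R zero    i e k []      = R-refl
      run-R (suc n) i e k (w ∷ y) =
        R-trans (run-R n (suc i) e′ (bucket (suc i) u) y)
                (subst (R _) (sym (accepts⁺-step i (rep i k) w (toList y))) (rep-R (suc i) n e′ u y))
        where
        u : Vertex (suc i)
        u = move⁺ i (rep i k) w
        e′ : suc i + n ≡ T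
        e′ = trans (sym (+-suc i n)) e

      automaton-R : ∀ z → R (evalA automaton z) (eval B z)
      automaton-R z = R-trans (run-R T 0 refl (initial automaton) z) (rep-R 0 T refl (just (start B)) z)

-- Elements of a list that are least for a key in a total order
-- (the fallback d is only returned for the empty list).
module _ {X : Set} (O : TotalOrder 0ℓ 0ℓ 0ℓ) (key : X → TotalOrder.Carrier O) where
  open TotalOrder O using () renaming (_≤_ to _⊑_)
  open Extrema O using (argmin; f[argmin]≤f[⊤]; f[argmin]≤f[xs]; argmin-sel)

  optimum : X → List X → X
  optimum d []       = d
  optimum d (y ∷ ys) = argmin key y ys

  optimum-spec : ∀ d {x xs} → x ∈ xs → optimum d xs ∈ xs × key (optimum d xs) ⊑ key x
  optimum-spec d {xs = y ∷ ys} x∈ = member , bound x∈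
    where
    member : argmin key y ys ∈ y ∷ ys
    member with argmin-sel key y ys
    ... | inj₁ is-y = here is-y
    ... | inj₂ ∈ys  = there ∈ys
    bound : ∀ {x} → x ∈ y ∷ ys → key (argmin key y ys) ⊑ key x
    bound (here refl) = f[argmin]≤f[⊤] {f = key} y ys
    bound (there ∈ys) = ListAll.lookup (f[argmin]≤f[xs] {f = key} y ys) ∈ys

implies⇒≤ : ∀ {a b} → (a ≡ true → b ≡ true) → a Bool.≤ b
implies⇒≤ {false} {b} _ = BoolP.≤-minimum b
implies⇒≤ {true}  h rewrite h refl = Bool.b≤b

reindex : ∀ {D m n} {P : List (Word D) → Set} → m ≡ n →
          (∀ (y : Vec (Word D) m) → P (toList y)) → ∀ (y : Vec (Word D) n) → P (toList y)
reindex refl h = h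

module MonotoneRounding {D T : ℕ} (B : BP D T) (mono : Monotone B) (q : ℕ) where
  open Rounding B q

  rankAt : ∀ i → Dec (i ≤ T) → Fin (width B i) → ℕ
  rankAt i (yes i≤T) = proj₁ (mono i i≤T)
  rankAt i (no _)    = λ _ → 0

  rank⁺ : ∀ i → Vertex i → ℕ
  rank⁺ i nothing  = 0
  rank⁺ i (just v) = suc (rankAt i (i ≤? T) v)

  rank-mono : ∀ i n → i + n ≡ T → ∀ {a b} → rank⁺ i a ≤ rank⁺ i b → (y : Vec (Word D) n) →
              accepts⁺ i a (toList y) Bool.≤ accepts⁺ i b (toList y)
  rank-mono i n e {nothing} _ y = BoolP.≤-minimum _
  rank-mono i n e {just v} {just w} (s≤s le) y with i ≤? T
  ... | no i≰T = ⊥-elim (i≰T (subst (i ≤_) e (m≤m+n i n)))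
  ... | yes i≤T with m≤n⇒m<n∨m≡n le
  ...   | inj₂ same = BoolP.≤-reflexive (cong (λ u → accepts B i u (toList y)) (proj₁ (proj₂ (mono i i≤T)) same))
  ...   | inj₁ lower-rank = implies⇒≤ (reindex {P = λ ys → accepts B i v ys ≡ true → accepts B i w ys ≡ true}
                                         (remaining e) (proj₂ (proj₂ (mono i i≤T)) v w lower-rank) y)

  module Extreme (_⊑_ : Rel ℕ 0ℓ) (⊑-total : IsTotalOrder _≡_ _⊑_) where
    order : TotalOrder 0ℓ 0ℓ 0ℓ
    order = record { isTotalOrder = ⊑-total }

    members : ∀ i → Fin (suc q) → List (Vertex i)
    members i k = filter (λ x → bucket i x Fin.≟ k) (vertices i)

    rep : ∀ i → Fin (suc q) → Vertex i
    rep i k = optimum order (rank⁺ i) nothing (members i k)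

    rep-spec : ∀ i x → bucket i (rep i (bucket i x)) ≡ bucket i x × rank⁺ i (rep i (bucket i x)) ⊑ rank⁺ i x
    rep-spec i x = proj₂ (∈-filter⁻ (λ y → bucket i y Fin.≟ bucket i x) (proj₁ spec)) , proj₂ spec
      where
      spec : rep i (bucket i x) ∈ members i (bucket i x) × rank⁺ i (rep i (bucket i x)) ⊑ rank⁺ i x
      spec = optimum-spec order (rank⁺ i) nothing
               (∈-filter⁺ (λ y → bucket i y Fin.≟ bucket i x) (∈-vertices i x) refl)

    open Represented rep (λ i x → proj₁ (rep-spec i x)) public

  module Lower = Extreme _≤_ ≤-isTotalOrder
  module Upper = Extreme _≥_ (TotalOrderProperties.≥-isTotalOrder ≤-totalOrder)

  lower≤B : ∀ z → evalA Lower.automaton z Bool.≤ eval B z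
  lower≤B = Lower.automaton-R Bool._≤_ BoolP.≤-refl BoolP.≤-trans
              (λ i n e x y → rank-mono i n e (proj₂ (Lower.rep-spec i x)) y)

  B≤upper : ∀ z → eval B z Bool.≤ evalA Upper.automaton z
  B≤upper = Upper.automaton-R (flip Bool._≤_) BoolP.≤-refl (flip BoolP.≤-trans)
              (λ i n e x y → rank-mono i n e (proj₂ (Upper.rep-spec i x)) y)

record Rounded {D T : ℕ} (B : BP D T) (q : ℕ) : Set where
  field
    lower upper : Automaton D (suc q)
    lower≤B     : ∀ z → evalA lower z Bool.≤ eval B z
    B≤upper     : ∀ z → eval B z Bool.≤ evalA upper z
    gap         : acceptances {n = T} (evalA upper) * q
                  ≤ acceptances {n = T} (evalA lower) * q + 2 * T * inputs D T

rounded : ∀ {D T} (B : BP D T) → Monotone B → (q : ℕ) → Rounded B q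
rounded {D} {T} B mono q = record
  { lower   = Lower.automaton
  ; upper   = Upper.automaton
  ; lower≤B = lower≤B
  ; B≤upper = B≤upper
  ; gap     = begin
      up * q               ≤⟨ proj₂ Upper.count-error ⟩
      N * q + TM           ≤⟨ +-monoˡ-≤ TM (proj₁ Lower.count-error) ⟩
      low * q + TM + TM    ≡⟨ solve 3 (λ l T M → l :+ T :* M :+ T :* M := l :+ con 2 :* T :* M) refl (low * q) T M ⟩
      low * q + 2 * T * M  ∎ }
  where
  open MonotoneRounding B mono q
  open ≤-Reasoning
  M TM N low up : ℕ
  M   = inputs D T
  TM  = T * M
  N   = acceptances (eval B)
  low = acceptances {n = T} (evalA Lower.automaton)
  up  = acceptances {n = T} (evalA Upper.automaton)

-- The product of d automata accepting when g accepts the vector of their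
-- outcomes; a tuple of states is encoded in Fin (K ^ d).
module _ {D K d : ℕ} (As : Fin d → Automaton D K) (g : Vec Bool d → Bool) where

  productBP : (T : ℕ) → BP D T
  productBP T = record
    { width = λ _ → K ^ d
    ; start = funToFin (λ j → initial (As j))
    ; next  = λ i e w → just (funToFin (λ j → move (As j) i (finToFun e j) w))
    ; label = λ i e → g (tabulate (λ j → output (As j) i (finToFun e j))) }

  decode-encode : ∀ i (ks : Fin d → Fin K) ys →
                  tabulate (λ j → run (As j) i (finToFun (funToFin ks) j) ys) ≡ tabulate (λ j → run (As j) i (ks j) ys)
  decode-encode i ks ys = tabulate-cong (λ j → cong (λ k → run (As j) i k ys) (finToFun-funToFin ks j))

  product-accepts : ∀ T i e ys → accepts (productBP T) i e ys ≡ g (tabulate (λ j → run (As j) i (finToFun e j) ys))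
  product-accepts T i e []       = refl
  product-accepts T i e (w ∷ ys) =
    trans (product-accepts T (suc i) _ ys)
          (cong g (decode-encode (suc i) (λ j → move (As j) i (finToFun e j) w) ys))

  product-eval : ∀ {T} z → eval (productBP T) z ≡ g (tabulate (λ j → evalA (As j) z))
  product-eval z = trans (product-accepts _ 0 _ (toList z))
                         (cong g (decode-encode 0 (λ j → initial (As j)) (toList z)))

ones : ∀ {n} → Vec Bool n → ℕ
ones v = Vec.sum (Vec.map indicator v)

pointwise-≤ : ∀ {n} {x y : Vec Bool n} → Pointwise Bool._≤_ x y → x ≡ y ⊎ ones x < ones y
pointwise-≤ [] = inj₁ refl
pointwise-≤ {x = a ∷ x} (a≤b ∷ x≤y) with pointwise-≤ x≤y | a≤b
... | inj₁ refl | Bool.b≤b = inj₁ refl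
... | inj₁ refl | Bool.f≤t = inj₂ ≤-refl
... | inj₂ more | Bool.b≤b = inj₂ (+-monoʳ-< (indicator a) more)
... | inj₂ more | Bool.f≤t = inj₂ (m<n⇒m<1+n more)

monotone-step : ∀ {n} {g : Vec Bool n → Bool} → MonotoneFn g → ∀ {x y} → Pointwise Bool._≤_ x y →
                indicator (g y) + ones x ≤ indicator (g x) + ones y
monotone-step {g = g} g-mono {x} {y} x≤y with pointwise-≤ x≤y
... | inj₁ refl = ≤-refl
... | inj₂ more = begin
  indicator (g y) + ones x ≤⟨ +-monoˡ-≤ (ones x) (indicator≤1 (g y)) ⟩
  suc (ones x)             ≤⟨ more ⟩
  ones y                   ≤⟨ m≤n+m (ones y) (indicator (g x)) ⟩
  indicator (g x) + ones y ∎
  where open ≤-Reasoning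

total-ones : ∀ {A : Set} (xs : List A) n {d} (f : Fin d → Vec A n → Bool) →
             total xs n (λ z → ones (tabulate (λ j → f j z))) ≡ Vec.sum (tabulate (λ j → total xs n (indicator ∘ f j)))
total-ones xs n {zero}  f = trans (total-const xs n 0) (*-zeroʳ (length xs ^ n))
total-ones xs n {suc d} f =
  trans (total-+ xs n _ _) (cong (total xs n (indicator ∘ f Fin.zero) +_) (total-ones xs n (f ∘ Fin.suc)))

union-bound : ∀ {D n d} {g : Vec Bool d → Bool} → MonotoneFn g →
              (lo hi : Fin d → Vec (Word D) n → Bool) → (∀ j z → lo j z Bool.≤ hi j z) →
              acceptances (λ z → g (tabulate (λ j → hi j z))) + Vec.sum (tabulate (λ j → acceptances (lo j)))
              ≤ acceptances (λ z → g (tabulate (λ j → lo j z))) + Vec.sum (tabulate (λ j → acceptances (hi j)))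
union-bound {D} {n} {d} {g} g-mono lo hi lo≤hi = begin
  total W n (λ z → indicator (g (hiz z))) + Vec.sum (tabulate (λ j → acceptances (lo j)))
    ≡⟨ cong (total W n (λ z → indicator (g (hiz z))) +_) (total-ones W n lo) ⟨
  total W n (λ z → indicator (g (hiz z))) + total W n (λ z → ones (loz z))
    ≡⟨ total-+ W n _ _ ⟨
  total W n (λ z → indicator (g (hiz z)) + ones (loz z))
    ≤⟨ total-mono W n (λ z → monotone-step g-mono (Pointwise.tabulate⁺ (λ j → lo≤hi j z))) ⟩
  total W n (λ z → indicator (g (loz z)) + ones (hiz z))
    ≡⟨ total-+ W n _ _ ⟩
  total W n (λ z → indicator (g (loz z))) + total W n (λ z → ones (hiz z))
    ≡⟨ cong (total W n (λ z → indicator (g (loz z))) +_) (total-ones W n hi) ⟩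
  total W n (λ z → indicator (g (loz z))) + Vec.sum (tabulate (λ j → acceptances (hi j))) ∎
  where
  open ≤-Reasoning
  W : List (Word D)
  W = allWords D
  loz hiz : Vec (Word D) n → Vec Bool d
  loz z = tabulate (λ j → lo j z)
  hiz z = tabulate (λ j → hi j z)

sum-gaps : ∀ {d} (a b : Fin d → ℕ) q c → (∀ j → a j * q ≤ b j * q + c) →
           Vec.sum (tabulate a) * q ≤ Vec.sum (tabulate b) * q + d * c
sum-gaps {zero}  a b q c _   = z≤n
sum-gaps {suc d} a b q c gap = begin
  (a₀ + Σa) * q             ≡⟨ *-distribʳ-+ q a₀ Σa ⟩
  a₀ * q + Σa * q           ≤⟨ +-mono-≤ (gap Fin.zero) (sum-gaps (a ∘ Fin.suc) (b ∘ Fin.suc) q c (gap ∘ Fin.suc)) ⟩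
  b₀ * q + c + (Σb * q + d * c) ≡⟨ solve 4 (λ b₀ Σb c d → b₀ :+ c :+ (Σb :+ d :* c) := b₀ :+ Σb :+ (c :+ d :* c)) refl (b₀ * q) (Σb * q) c d ⟩
  b₀ * q + Σb * q + suc d * c    ≡⟨ cong (_+ suc d * c) (*-distribʳ-+ q b₀ Σb) ⟨
  (b₀ + Σb) * q + suc d * c ∎
  where
  open ≤-Reasoning
  a₀ b₀ Σa Σb : ℕ
  a₀ = a Fin.zero
  b₀ = b Fin.zero
  Σa = Vec.sum (tabulate (a ∘ Fin.suc))
  Σb = Vec.sum (tabulate (b ∘ Fin.suc))

record Sandwiching {D T : ℕ} (f : Vec (Word D) T → Bool) (K q E : ℕ) : Set where
  field
    down up    : BP D T
    down-width : ∀ i → width down i ≡ K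
    up-width   : ∀ i → width up i ≡ K
    sandwiches : ∀ z → (eval down z Bool.≤ f z) × (f z Bool.≤ eval up z)
    count-gap  : acceptances (eval up) * q ≤ acceptances (eval down) * q + E

combine-gaps : ∀ {cu cd} Sl Sh q E → cu + Sl ≤ cd + Sh → Sh * q ≤ Sl * q + E → cu * q ≤ cd * q + E
combine-gaps {cu} {cd} Sl Sh q E union coordinates = +-cancelʳ-≤ (Sl * q) (cu * q) (cd * q + E) (begin
  cu * q + Sl * q     ≡⟨ *-distribʳ-+ q cu Sl ⟨
  (cu + Sl) * q       ≤⟨ *-monoˡ-≤ q union ⟩
  (cd + Sh) * q       ≡⟨ *-distribʳ-+ q cd Sh ⟩
  cd * q + Sh * q     ≤⟨ +-monoʳ-≤ (cd * q) coordinates ⟩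
  cd * q + (Sl * q + E) ≡⟨ solve 3 (λ c s e → c :+ (s :+ e) := c :+ e :+ s) refl (cd * q) (Sl * q) E ⟩
  cd * q + E + Sl * q ∎)
  where open ≤-Reasoning

product-sandwich : ∀ {D T d} (q : ℕ) (Bs : Vec (BP D T) d) → (∀ j → Monotone (Vec.lookup Bs j)) →
                   (g : Vec Bool d → Bool) → MonotoneFn g →
                   Sandwiching (λ z → g (Vec.map (λ B → eval B z) Bs)) (suc q ^ d) q (d * (2 * T * inputs D T))
product-sandwich {D} {T} {d} q Bs mono g g-mono = record
  { down       = productBP lows g T
  ; up         = productBP highs g T
  ; down-width = λ _ → refl
  ; up-width   = λ _ → refl
  ; sandwiches = λ z → below z , above z
  ; count-gap  = combine-gaps Σlow Σhigh q (d * (2 * T * inputs D T)) union coordinates }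
  where
  R : ∀ j → Rounded (Vec.lookup Bs j) q
  R j = rounded (Vec.lookup Bs j) (mono j) q
  lows highs : Fin d → Automaton D (suc q)
  lows j  = Rounded.lower (R j)
  highs j = Rounded.upper (R j)
  outcomes : ∀ z → tabulate (λ j → eval (Vec.lookup Bs j) z) ≡ Vec.map (λ B → eval B z) Bs
  outcomes z = trans (tabulate-∘ (λ B → eval B z) (Vec.lookup Bs)) (cong (Vec.map _) (tabulate∘lookup Bs))
  below : ∀ z → eval (productBP lows g T) z Bool.≤ g (Vec.map (λ B → eval B z) Bs)
  below z = subst₂ Bool._≤_ (sym (product-eval lows g z)) (cong g (outcomes z))
              (g-mono _ _ (Pointwise.tabulate⁺ (λ j → Rounded.lower≤B (R j) z)))
  above : ∀ z → g (Vec.map (λ B → eval B z) Bs) Bool.≤ eval (productBP highs g T) z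
  above z = subst₂ Bool._≤_ (cong g (outcomes z)) (sym (product-eval highs g z))
              (g-mono _ _ (Pointwise.tabulate⁺ (λ j → Rounded.B≤upper (R j) z)))
  count-as-product : ∀ As → acceptances {n = T} (λ z → g (tabulate (λ j → evalA (As j) z)))
                           ≡ acceptances (eval (productBP As g T))
  count-as-product As = total-cong (allWords D) T (λ z → cong indicator (sym (product-eval As g z)))
  Σlow Σhigh : ℕ
  Σlow  = Vec.sum (tabulate (λ j → acceptances {n = T} (evalA (lows j))))
  Σhigh = Vec.sum (tabulate (λ j → acceptances {n = T} (evalA (highs j))))
  union : acceptances (eval (productBP highs g T)) + Σlow ≤ acceptances (eval (productBP lows g T)) + Σhigh
  union = subst₂ (λ u l → u + Σlow ≤ l + Σhigh) (count-as-product highs) (count-as-product lows)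
            (union-bound g-mono (λ j → evalA (lows j)) (λ j → evalA (highs j))
               (λ j z → BoolP.≤-trans (Rounded.lower≤B (R j) z) (Rounded.B≤upper (R j) z)))
  coordinates : Σhigh * q ≤ Σlow * q + d * (2 * T * inputs D T)
  coordinates = sum-gaps (λ j → acceptances {n = T} (evalA (highs j))) (λ j → acceptances {n = T} (evalA (lows j)))
                         q (2 * T * inputs D T) (λ j → Rounded.gap (R j))


record Resolution (T num den : ℕ) : Set where
  field
    q      : ℕ
    fine   : 2 * T * den ≤ q * num
    coarse : suc q * num ≤ 4 * T * den

resolution : ∀ {T num den} → 1 ≤ T → num > 0 → num < den → Resolution T num den
resolution {T} {num} {den} T≥1 num>0 num<den = record
  { q = x / num + 1 ; fine = fine ; coarse = coarse }
  where
  open ≤-Reasoning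
  instance _ = >-nonZero num>0
  x : ℕ
  x = 2 * T * den
  fine : x ≤ (x / num + 1) * num
  fine = begin
    x                       ≡⟨ m≡m%n+[m/n]*n x num ⟩
    x % num + x / num * num ≤⟨ +-monoˡ-≤ (x / num * num) (<⇒≤ (m%n<n x num)) ⟩
    num + x / num * num     ≡⟨ solve 2 (λ y n → n :+ y :* n := (y :+ con 1) :* n) refl (x / num) num ⟩
    (x / num + 1) * num     ∎
  two-den : den + den ≤ x
  two-den = begin
    den + den     ≡⟨ solve 1 (λ d → d :+ d := con 2 :* con 1 :* d) refl den ⟩
    2 * 1 * den   ≤⟨ *-monoˡ-≤ den (*-monoʳ-≤ 2 T≥1) ⟩
    x             ∎
  coarse : suc (x / num + 1) * num ≤ 4 * T * den
  coarse = begin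
    suc (x / num + 1) * num     ≡⟨ solve 2 (λ y n → (con 1 :+ (y :+ con 1)) :* n := y :* n :+ (n :+ n)) refl (x / num) num ⟩
    x / num * num + (num + num) ≤⟨ +-mono-≤ (m/n*n≤m x num) (+-mono-≤ (<⇒≤ num<den) (<⇒≤ num<den)) ⟩
    x + (den + den)             ≤⟨ +-monoʳ-≤ x two-den ⟩
    x + x                       ≡⟨ solve 2 (λ T d → con 2 :* T :* d :+ con 2 :* T :* d := con 4 :* T :* d) refl T den ⟩
    4 * T * den                 ∎

rescale : ∀ {a b q num den t G} → t > 0 → t * den ≤ q * num → a * q ≤ b * q + t * G →
          a * den ≤ b * den + G * num
rescale {a} {b} {q} {num} {den} {t} {G} t>0 fine gap with ≤-total a b
... | inj₁ a≤b = ≤-trans (*-monoˡ-≤ den a≤b) (m≤m+n (b * den) (G * num))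
... | inj₂ b≤a = begin
  a * den           ≡⟨ cong (_* den) (m+[n∸m]≡n b≤a) ⟨
  (b + e) * den     ≡⟨ *-distribʳ-+ den b e ⟩
  b * den + e * den ≤⟨ +-monoʳ-≤ (b * den) excess ⟩
  b * den + G * num ∎
  where
  open ≤-Reasoning
  e : ℕ
  e = a ∸ b
  excess-q : e * q ≤ t * G
  excess-q = +-cancelˡ-≤ (b * q) (e * q) (t * G)
    (subst (_≤ b * q + t * G) (trans (cong (_* q) (sym (m+[n∸m]≡n b≤a))) (*-distribʳ-+ q b e)) gap)
  excess : e * den ≤ G * num
  excess = *-cancelˡ-≤ t {{>-nonZero t>0}} (begin
    t * (e * den)  ≡⟨ solve 3 (λ t e d → t :* (e :* d) := e :* (t :* d)) refl t e den ⟩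
    e * (t * den)  ≤⟨ *-monoʳ-≤ e fine ⟩
    e * (q * num)  ≡⟨ *-assoc e q num ⟨
    e * q * num    ≤⟨ *-monoˡ-≤ num excess-q ⟩
    t * G * num    ≡⟨ *-assoc t G num ⟩
    t * (G * num)  ∎)

probability-gap : ∀ {D T ε} d q (F G : Vec (Word D) T → Bool) (fraction : ProperFraction ε) →
                  T > 0 → 2 * T * ProperFraction.den fraction ≤ q * ProperFraction.num fraction →
                  acceptances F * q ≤ acceptances G * q + d * (2 * T * inputs D T) →
                  Pr D T F ℚ.- Pr D T G ℚ.≤ ι d ℚ.* ε
probability-gap {D} {T} {ε} d q F G fraction T>0 fine gap =
  fraction-gap (count D T F) (count D T G) d (2 ^ (D * T)) {{m^n≢0 2 (D * T)}} ε num den {{den≢0}} ε·den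
    (rescale {count D T F} {count D T G} {q} {t = 2 * T} (≤-trans T>0 (m≤m+n T (T + 0))) fine count-gap)
  where
  open ProperFraction fraction
  count-gap : count D T F * q ≤ count D T G * q + 2 * T * (d * 2 ^ (D * T))
  count-gap = subst₂ (λ a b → a * q ≤ b * q + 2 * T * (d * 2 ^ (D * T)))
    (sym (count≡acceptances D T F)) (sym (count≡acceptances D T G))
    (subst (λ E → acceptances F * q ≤ acceptances G * q + E)
      (trans (cong (λ M → d * (2 * T * M)) (inputs≡ D T))
             (solve 3 (λ d T M → d :* (con 2 :* T :* M) := con 2 :* T :* (d :* M)) refl d T (2 ^ (D * T))))
      gap)

lemma8p6 : (S D T d : ℕ) → 1 ≤ T → (ε : ℚ) → (ε>0 : 0ℚ ℚ.< ε) → ε ℚ.< 1ℚ →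
    (Bs : Vec (BP D T) d) → (g : Vec Bool d → Bool) →
    All (λ B → HasSpace B S × Monotone B) Bs →
    MonotoneFn g →
    Σ (BP D T) λ Bdown → Σ (BP D T) λ Bup →
      WidthAtMostℚ Bdown (sandwichWidth d T ε ε>0) ×
      WidthAtMostℚ Bup (sandwichWidth d T ε ε>0) ×
      Sandwiches D T ((ℤ.+ d ℚ./ 1) ℚ.* ε) (eval Bdown)
        (λ z → g (Vec.map (λ B → eval B z) Bs)) (eval Bup)
lemma8p6 S D T d T≥1 ε ε>0 ε<1 Bs g Bs-monotone g-monotone =
  down , up , within-width down down-width , within-width up up-width ,
  sandwiches , probability-gap d q (eval up) (eval down) fraction T≥1 fine count-gap
  where
  fraction : ProperFraction ε
  fraction = proper-fraction ε ε>0 ε<1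
  open ProperFraction fraction
  open Resolution (resolution T≥1 num>0 num<den)
  open Sandwiching (product-sandwich q Bs (λ j → proj₂ (lookup⁺ Bs-monotone j)) g g-monotone)
  width-bound : ι (suc q ^ d) ℚ.≤ sandwichWidth d T ε ε>0
  width-bound = subst (ℚ._≤ sandwichWidth d T ε ε>0) (sym (ι-pow (suc q) d))
    (powℚ-mono (ι-mono {0} {suc q} z≤n) (below-inverse (suc q) (4 * T) ε {{ℚ.positive ε>0}} num den {{den≢0}} ε·den coarse) d)
  within-width : ∀ (B : BP D T) → (∀ i → width B i ≡ suc q ^ d) → WidthAtMostℚ B (sandwichWidth d T ε ε>0)
  within-width B has-width i _ = subst (λ k → ι k ℚ.≤ sandwichWidth d T ε ε>0) (sym (has-width i)) width-bound
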